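{- Let $p\ge0$ and $Q=(q_1,\dots,q_J,e_0)\in M_p$. Then $C_p^\infty(Q)=V(A_p^\infty(Q))$.
   Context: $M$ is the set of integer vectors $(v_1,\dots,v_{J+1})$ with $J\ge1$ odd, $v_i\ge1$ for $1\le i\le J$, $v_{J+1}\ge0$; $M_p=\{V\in M: v_1+v_3+\cdots+v_J\ge p+1\}$. For $Q=(q_1,\dots,q_J,e_0)\in M_p$ let $A=A(Q)=1_{q_1}0_{q_2}1_{q_3}\cdots1_{q_J}0_{e_0}$ (where $1_q,0_q$ denote $q$ consecutive 1's or 0's), $n=length(A)$, $k=w(A)-(p+1)$ with $w(A)$ the number of 1's. $A_p^\infty(Q)=a_1a_2\cdots$ is generated from $A=a_1\cdots a_n$ by the symmetric shift register with parameters $k,p,n$: for $i\ge0$, $a_{n+i+1}=1-a_{i+1}$ if $k\le a_{i+2}+\cdots+a_{i+n}\le k+p$, and $a_{n+i+1}=a_{i+1}$ otherwise. This sequence starts with 1 and contains infinitely many 0's and 1's; writing it uniquely as $1_{r_1}0_{r_2}1_{r_3}\cdots$ with all $r_i\ge1$, $V(A_p^\infty(Q))=(r_1,r_2,\dots)$. Shift symmetric vector: $\lambda_0=p+1$, and for $j\ge0$: if $j$ is even, $s_{j+1}=\min\{q_{j+1},\lambda_j\}$, $\lambda_{j+1}=\lambda_j-s_{j+1}$; if $j$ is odd, $s_{j+1}=\min\{q_{j+1},p+1-\lambda_j\}$, $\lambda_{j+1}=\lambda_j+s_{j+1}$; always $e_{j+1}=q_{j+1}-s_{j+1}$ and $q_{J+j+1}=e_j+s_{j+1}$.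 Then $C_p^\infty(Q)=(q_1,q_2,q_3,\dots)$. -}

module Defs where

open import Data.Nat using (ℕ; zero; suc; _+_; _∸_; _≤_; _<_; _≤ᵇ_; _⊓_)
open import Data.Bool using (Bool; true; false; if_then_else_; _∧_)
open import Data.List using (List; []; _∷_; _++_; replicate; length; [_])
open import Data.Nat.ListAction using (sum)
open import Data.Product using (_×_)
open import Relation.Binary.PropositionalEquality using (_≡_)

isEven : ℕ → Bool
isEven zero = true
isEven (suc n) with isEven n
... | true = false
... | false = true

Odd : ℕ → Set
Odd n = isEven n ≡ false

mutual
  oddSum : List ℕ → ℕ
  oddSum [] = 0
  oddSum (x ∷ xs) = x + evenSum xs

  evenSum : List ℕ → ℕ
  evenSum [] = 0
  evenSum (x ∷ xs) = oddSum xs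

-- Membership in M_p, for Q = (q₁,…,q_J,e₀) with qs = [q₁,…,q_J]
data AllPos : List ℕ → Set where
  []  : AllPos []
  _∷_ : ∀ {x xs} → 1 ≤ x → AllPos xs → AllPos (x ∷ xs)

InMp : ℕ → List ℕ → ℕ → Set
InMp p qs e0 = Odd (length qs) × AllPos qs × (suc p ≤ oddSum qs)

-- A(Q) = 1_{q₁} 0_{q₂} 1_{q₃} ⋯ 1_{q_J} 0_{e₀}   (bits as ℕ in {0,1})

blocks : ℕ → List ℕ → List ℕ
blocks b [] = []
blocks b (x ∷ xs) = replicate x b ++ blocks (1 ∸ b) xs

wordA : List ℕ → ℕ → List ℕ
wordA qs e0 = blocks 1 qs ++ replicate e0 0

head0 : List ℕ → ℕ
head0 [] = 0
head0 (x ∷ _) = x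

-- one step of the symmetric shift register with parameters k, p (n = window length):
-- window (a_{i+1},…,a_{i+n}) ↦ (a_{i+2},…,a_{i+n+1})
srStep : ℕ → ℕ → List ℕ → List ℕ
srStep k p [] = []
srStep k p (x ∷ rest) =
  rest ++ [ (if (k ≤ᵇ sum rest) ∧ (sum rest ≤ᵇ k + p) then 1 ∸ x else x) ]

-- window at time i, i.e. (a_{i+1},…,a_{i+n}); k = w(A) − (p+1)
srWindow : ℕ → List ℕ → ℕ → ℕ → List ℕ
srWindow p qs e0 zero = wordA qs e0
srWindow p qs e0 (suc i) = srStep (sum (wordA qs e0) ∸ suc p) p (srWindow p qs e0 i)

-- A_p^∞(Q), 0-indexed: Aseq p qs e0 m = a_{m+1}
Aseq : ℕ → List ℕ → ℕ → ℕ → ℕ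
Aseq p qs e0 m = head0 (srWindow p qs e0 m)

-- C_p^∞(Q): state at step j is (λ_j , e_j , (q_{j+1},…,q_{J+j}))

record CState : Set where
  constructor cst
  field
    lam : ℕ
    err : ℕ
    win : List ℕ

cStep : ℕ → ℕ → CState → CState
cStep p j (cst l e []) = cst l e []
cStep p j (cst l e (q ∷ rest)) =
  let s  = if isEven j then q ⊓ l else q ⊓ (suc p ∸ l)
      l' = if isEven j then l ∸ s else l + s
  in cst l' (q ∸ s) (rest ++ [ e + s ])

cState : ℕ → List ℕ → ℕ → ℕ → CState
cState p qs e0 zero = cst (suc p) e0 qs
cState p qs e0 (suc j) = cStep p j (cState p qs e0 j)

-- C_p^∞(Q), 0-indexed: Cseq p qs e0 m = q_{m+1}
Cseq : ℕ → List ℕ → ℕ → ℕ → ℕ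
Cseq p qs e0 m = head0 (CState.win (cState p qs e0 m))

-- V(a) = r  ⟺  a = 1_{r₁} 0_{r₂} 1_{r₃} ⋯ with all r_i ≥ 1 (0-indexed r)

partialSum : (ℕ → ℕ) → ℕ → ℕ
partialSum r zero = 0
partialSum r (suc j) = partialSum r j + r j

runBit : ℕ → ℕ
runBit j = if isEven j then 1 else 0

IsRunLengthVector : (ℕ → ℕ) → (ℕ → ℕ) → Set
IsRunLengthVector r a =
  (∀ j → 1 ≤ r j) ×
  (∀ j m → partialSum r j ≤ m → m < partialSum r (suc j) → a m ≡ runBit j)

-- Follow the register block by block. At the start of block j the window is the word
-- 1_{q_{j+1}} 0_{q_{j+2}} ⋯ 1_{q_{J+j}} 0_{e_j} (with 0 and 1 exchanged for odd j) and has
-- weight k + λ_j. While the leading run of q_{j+1} bits is shifted out, the feedback sum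
-- moves by one per flip, so the register flips for exactly s_{j+1} steps and then copies;
-- the s_{j+1} flipped bits join the old tail of e_j bits into the last block and the
-- q_{j+1} − s_{j+1} copied ones form the new tail, which is the shift-symmetric update.
-- The output during block j is the run being shifted out, of length q_{j+1}.

module Submission where

open import Defs
open import Data.Bool using (Bool; true; false; not; if_then_else_; _∧_; T)
open import Data.Bool.Properties using (T-≡; not-involutive)
open import Data.List using (List; []; _∷_; _++_; [_]; replicate; length; drop)
open import Data.List.Properties using (++-assoc; ++-identityʳ; length-++; drop-[])
open import Data.Nat
open import Data.Nat.ListAction using (sum)
open import Data.Nat.ListAction.Properties using (sum-++)
open import Data.Nat.Properties
open import Data.Nat.Tactic.RingSolver using (solve-∀)
open import Data.Product using (_×_; _,_; ∃; proj₁; proj₂)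
open import Data.Sum using (inj₁; inj₂)
open import Function.Bundles using (Equivalence)
open import Relation.Binary.PropositionalEquality hiding ([_])
open import Relation.Nullary using (contradiction)

m∸m⊓n≢0⇒m⊓n≡n : ∀ {m n} → m ∸ m ⊓ n ≢ 0 → m ⊓ n ≡ n
m∸m⊓n≢0⇒m⊓n≡n {m} {n} m∸m⊓n≢0 with ⊓-sel m n
... | inj₁ m⊓n≡m = contradiction m⊓n≡m (<⇒≢ (m∸n≢0⇒n<m m∸m⊓n≢0))
... | inj₂ m⊓n≡n = m⊓n≡n

m+o⊓[n∸m]≤n : ∀ {m n} o → m ≤ n → m + o ⊓ (n ∸ m) ≤ n
m+o⊓[n∸m]≤n {m} {n} o m≤n =
  ≤-trans (+-monoʳ-≤ m (m⊓n≤n o (n ∸ m))) (≤-reflexive (m+[n∸m]≡n m≤n))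

replicate-snoc : ∀ n (x : ℕ) → replicate n x ++ [ x ] ≡ replicate (suc n) x
replicate-snoc zero    x = refl
replicate-snoc (suc n) x = cong (x ∷_) (replicate-snoc n x)

replicate-+ : ∀ m n (x : ℕ) → replicate m x ++ replicate n x ≡ replicate (m + n) x
replicate-+ zero    n x = refl
replicate-+ (suc m) n x = cong (x ∷_) (replicate-+ m n x)

sum-replicate : ∀ n x → sum (replicate n x) ≡ n * x
sum-replicate zero    x = refl
sum-replicate (suc n) x = cong (x +_) (sum-replicate n x)

sum-replicate-++ : ∀ n b (L : List ℕ) → sum (replicate n b ++ L) ≡ n * b + sum L
sum-replicate-++ n b L = trans (sum-++ (replicate n b) L) (cong (_+ sum L) (sum-replicate n b))

sum-++-replicate : ∀ (L : List ℕ) n b → sum (L ++ replicate n b) ≡ sum L + n * b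
sum-++-replicate L n b = trans (sum-++ L (replicate n b)) (cong (sum L +_) (sum-replicate n b))

sum-run-tail : ∀ v b (L : List ℕ) i x →
               sum (replicate v b ++ L ++ replicate i x) ≡ v * b + (sum L + i * x)
sum-run-tail v b L i x = trans (sum-replicate-++ v b _) (cong (v * b +_) (sum-++-replicate L i x))

sum-phase-end : ∀ (Y : List ℕ) s c r b → sum ((Y ++ replicate s c) ++ replicate r b) ≡ sum Y + s * c + r * b
sum-phase-end Y s c r b = trans (sum-++-replicate (Y ++ replicate s c) r b) (cong (_+ r * b) (sum-++-replicate Y s c))

drop-++-prefix : ∀ i (xs ys : List ℕ) → ∃ λ zs → drop i (xs ++ ys) ≡ drop i xs ++ zs
drop-++-prefix zero    xs       ys = ys , refl
drop-++-prefix (suc i) []       ys = drop (suc i) ys , refl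
drop-++-prefix (suc i) (x ∷ xs) ys = drop-++-prefix i xs ys

head-drop-replicate : ∀ {i q} (b : ℕ) (Z ext : List ℕ) → i < q →
                      head0 (drop i (replicate q b ++ Z) ++ ext) ≡ b
head-drop-replicate {zero}  {suc q} b Z ext _         = refl
head-drop-replicate {suc i} {suc q} b Z ext (s≤s i<q) = head-drop-replicate b Z ext i<q

bit : Bool → ℕ
bit b = if b then 1 else 0

isEven-suc : ∀ n → isEven (suc n) ≡ not (isEven n)
isEven-suc n with isEven n
... | true  = refl
... | false = refl

isEven-suc-suc : ∀ n → isEven (suc (suc n)) ≡ isEven n
isEven-suc-suc n = trans (isEven-suc (suc n)) (trans (cong not (isEven-suc n)) (not-involutive (isEven n)))

even-pred : ∀ n → Odd (suc n) → isEven n ≡ true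
even-pred n odd = trans (sym (not-involutive (isEven n))) (cong not (trans (sym (isEven-suc n)) odd))

odd-length-snoc : ∀ {x} (rest : List ℕ) → Odd (suc (length rest)) → Odd (length (rest ++ [ x ]))
odd-length-snoc rest odd = trans (cong isEven (trans (length-++ rest) (+-comm (length rest) 1))) odd

AllPos-snoc : ∀ {x} {xs : List ℕ} → AllPos xs → 1 ≤ x → AllPos (xs ++ [ x ])
AllPos-snoc []         1≤x = 1≤x ∷ []
AllPos-snoc (1≤y ∷ ps) 1≤x = 1≤y ∷ AllPos-snoc ps 1≤x

head-positive : ∀ {qs} → Odd (length qs) → AllPos qs → 1 ≤ head0 qs
head-positive {[]}    ()
head-positive {_ ∷ _} _  (1≤q ∷ _) = 1≤q

complement-involutive : ∀ b → 1 ∸ (1 ∸ bit b) ≡ bit b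
complement-involutive true  = refl
complement-involutive false = refl

blocks-snoc : ∀ b (xs : List ℕ) x → isEven (length xs) ≡ true →
              blocks (bit b) (xs ++ [ x ]) ≡ blocks (bit b) xs ++ replicate x (bit b)
blocks-snoc b []           x _  = ++-identityʳ _
blocks-snoc b (_ ∷ [])     x ()
blocks-snoc b (a ∷ c ∷ xs) x ev
  rewrite complement-involutive b
        | blocks-snoc b xs x (trans (sym (isEven-suc-suc (length xs))) ev)
  = sym (trans (++-assoc (replicate a (bit b)) _ (replicate x (bit b)))
               (cong (replicate a (bit b) ++_) (++-assoc (replicate c (1 ∸ bit b)) _ _)))

blocks-absorb : ∀ b (rest : List ℕ) e s → isEven (length rest) ≡ true →
  (blocks (bit b) rest ++ replicate e (bit b)) ++ replicate s (bit b) ≡ blocks (bit b) (rest ++ [ e + s ])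
blocks-absorb b rest e s ev = begin
  (blocks (bit b) rest ++ replicate e (bit b)) ++ replicate s (bit b)
    ≡⟨ ++-assoc (blocks (bit b) rest) _ _ ⟩
  blocks (bit b) rest ++ replicate e (bit b) ++ replicate s (bit b)
    ≡⟨ cong (blocks (bit b) rest ++_) (replicate-+ e s (bit b)) ⟩
  blocks (bit b) rest ++ replicate (e + s) (bit b)
    ≡⟨ sym (blocks-snoc b rest (e + s) ev) ⟩
  blocks (bit b) (rest ++ [ e + s ]) ∎
  where open ≡-Reasoning

mutual
  sum-blocks-1 : ∀ xs → sum (blocks 1 xs) ≡ oddSum xs
  sum-blocks-1 []       = refl
  sum-blocks-1 (x ∷ xs) = trans (sum-replicate-++ x 1 _) (cong₂ _+_ (*-identityʳ x) (sum-blocks-0 xs))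

  sum-blocks-0 : ∀ xs → sum (blocks 0 xs) ≡ evenSum xs
  sum-blocks-0 []       = refl
  sum-blocks-0 (x ∷ xs) = trans (sum-replicate-++ x 0 _) (cong₂ _+_ (*-zeroʳ x) (sum-blocks-1 xs))

sum-wordA : ∀ qs e0 → sum (wordA qs e0) ≡ oddSum qs
sum-wordA qs e0 = trans (sum-++-replicate (blocks 1 qs) e0 0)
                        (trans (cong₂ _+_ (sum-blocks-1 qs) (*-zeroʳ e0)) (+-identityʳ (oddSum qs)))

inBand : ℕ → ℕ → ℕ → Bool
inBand K p X = (K ≤ᵇ X) ∧ (X ≤ᵇ K + p)

nextBit : ℕ → ℕ → ℕ → List ℕ → ℕ
nextBit K p b w = if inBand K p (sum w) then 1 ∸ b else b

nextBit-by-band : ∀ K p b w {X c} → sum w ≡ X → inBand K p X ≡ c →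
                  nextBit K p b w ≡ (if c then 1 ∸ b else b)
nextBit-by-band K p b w w≡X band = cong (λ c → if c then 1 ∸ b else b) (trans (cong (inBand K p) w≡X) band)

≤ᵇ-true : ∀ {m n} → m ≤ n → (m ≤ᵇ n) ≡ true
≤ᵇ-true m≤n = Equivalence.to T-≡ (≤⇒≤ᵇ m≤n)

≤ᵇ-false : ∀ {m n} → n < m → (m ≤ᵇ n) ≡ false
≤ᵇ-false {m} {n} n<m with m ≤ᵇ n in eq
... | false = refl
... | true  = contradiction (≤ᵇ⇒≤ m n (subst T (sym eq) _)) (<⇒≱ n<m)

inBand-true : ∀ {K p X} → K ≤ X → X ≤ K + p → inBand K p X ≡ true
inBand-true K≤X X≤K+p rewrite ≤ᵇ-true K≤X | ≤ᵇ-true X≤K+p = refl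

inBand-below : ∀ {K p X} → X < K → inBand K p X ≡ false
inBand-below X<K rewrite ≤ᵇ-false X<K = refl

inBand-above : ∀ {K p X} → K + p < X → inBand K p X ≡ false
inBand-above {K} {p} {X} K+p<X with K ≤ᵇ X
... | false = refl
... | true  = ≤ᵇ-false K+p<X

inBand-deficit : ∀ {K p X d l} → X + d ≡ K + l → d ≤ l → l ≤ p + d → inBand K p X ≡ true
inBand-deficit {K} {p} {X} {d} {l} eq d≤l l≤p+d = inBand-true
  (+-cancelʳ-≤ d K X (≤-trans (+-monoʳ-≤ K d≤l) (≤-reflexive (sym eq))))
  (+-cancelʳ-≤ d X (K + p) (≤-trans (≤-reflexive eq)
    (≤-trans (+-monoʳ-≤ K l≤p+d) (≤-reflexive (sym (+-assoc K p d))))))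

-- In the even phase each flip shifts out a 1 and appends a 0, so after i flips the
-- feedback sum is k + λ − (i + 1); in the odd phase it is k + λ + i. It leaves the band
-- [k, k + p] exactly when the s_{j+1} flips are used up.

module EvenPhaseArithmetic (K p l s r σ : ℕ) (total : (s + r) * 1 + σ ≡ K + l)
                           (s≤l : s ≤ l) (l≤1+p : l ≤ suc p) where

  flip-in-band : ∀ i v → suc (i + v) ≡ s → inBand K p (v * 1 + (r * 1 + σ + i * 0)) ≡ true
  flip-in-band i v eq = inBand-deficit deficit
    (≤-trans (≤-trans (s≤s (m≤m+n i v)) (≤-reflexive eq)) s≤l)
    (≤-trans l≤1+p (≤-trans (s≤s (m≤m+n p i)) (≤-reflexive (sym (+-suc p i)))))
    where
    open ≡-Reasoning
    rearrange : ∀ v r σ i → v * 1 + (r * 1 + σ + i * 0) + suc i ≡ (suc (i + v) + r) * 1 + σ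
    rearrange = solve-∀
    deficit : v * 1 + (r * 1 + σ + i * 0) + suc i ≡ K + l
    deficit = begin
      v * 1 + (r * 1 + σ + i * 0) + suc i ≡⟨ rearrange v r σ i ⟩
      (suc (i + v) + r) * 1 + σ           ≡⟨ cong (λ n → (n + r) * 1 + σ) eq ⟩
      (s + r) * 1 + σ                     ≡⟨ total ⟩
      K + l ∎

  copy-below-band : ∀ i v → suc (i + v) ≡ r → s ≡ l → inBand K p (v * 1 + (σ + s * 0 + i * 1)) ≡ false
  copy-below-band i v eq s≡l = inBand-below (≤-reflexive (+-cancelʳ-≡ s _ K excess))
    where
    open ≡-Reasoning
    rearrange : ∀ v s σ i → suc (v * 1 + (σ + s * 0 + i * 1)) + s ≡ (s + suc (i + v)) * 1 + σ
    rearrange = solve-∀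
    excess : suc (v * 1 + (σ + s * 0 + i * 1)) + s ≡ K + s
    excess = begin
      suc (v * 1 + (σ + s * 0 + i * 1)) + s ≡⟨ rearrange v s σ i ⟩
      (s + suc (i + v)) * 1 + σ             ≡⟨ cong (λ n → (s + n) * 1 + σ) eq ⟩
      (s + r) * 1 + σ                       ≡⟨ total ⟩
      K + l                                 ≡⟨ cong (K +_) (sym s≡l) ⟩
      K + s ∎

  weight-after : σ + s * 0 + r * 1 ≡ K + (l ∸ s)
  weight-after = +-cancelʳ-≡ s _ _ (begin
    σ + s * 0 + r * 1 + s ≡⟨ rearrange σ s r ⟩
    (s + r) * 1 + σ       ≡⟨ total ⟩
    K + l                 ≡⟨ cong (K +_) (sym (m∸n+n≡m s≤l)) ⟩
    K + (l ∸ s + s)       ≡⟨ sym (+-assoc K (l ∸ s) s) ⟩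
    K + (l ∸ s) + s ∎)
    where
    open ≡-Reasoning
    rearrange : ∀ σ s r → σ + s * 0 + r * 1 + s ≡ (s + r) * 1 + σ
    rearrange = solve-∀

module OddPhaseArithmetic (K p l s r σ : ℕ) (total : (s + r) * 0 + σ ≡ K + l) where

  flip-in-band : ∀ i v → suc (i + v) ≡ s → l + s ≤ suc p → inBand K p (v * 0 + (r * 0 + σ + i * 1)) ≡ true
  flip-in-band i v eq l+s≤1+p =
    subst (λ X → inBand K p X ≡ true) (sym value) (inBand-true (m≤m+n K (l + i)) (+-monoʳ-≤ K l+i≤p))
    where
    open ≡-Reasoning
    rearrange : ∀ v r s σ i → v * 0 + (r * 0 + σ + i * 1) ≡ (s + r) * 0 + σ + i
    rearrange = solve-∀
    value : v * 0 + (r * 0 + σ + i * 1) ≡ K + (l + i)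
    value = begin
      v * 0 + (r * 0 + σ + i * 1) ≡⟨ rearrange v r s σ i ⟩
      (s + r) * 0 + σ + i         ≡⟨ cong (_+ i) total ⟩
      K + l + i                   ≡⟨ +-assoc K l i ⟩
      K + (l + i) ∎
    l+i≤p : l + i ≤ p
    l+i≤p = ≤-pred (subst (_≤ suc p) (+-suc l i)
              (≤-trans (+-monoʳ-≤ l (≤-trans (s≤s (m≤m+n i v)) (≤-reflexive eq))) l+s≤1+p))

  copy-above-band : ∀ i v → l + s ≡ suc p → inBand K p (v * 0 + (σ + s * 1 + i * 0)) ≡ false
  copy-above-band i v l+s≡1+p = inBand-above {K} {p} (≤-reflexive (sym value))
    where
    open ≡-Reasoning
    rearrange : ∀ v r s σ i → v * 0 + (σ + s * 1 + i * 0) ≡ (s + r) * 0 + σ + s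
    rearrange = solve-∀
    value : v * 0 + (σ + s * 1 + i * 0) ≡ suc (K + p)
    value = begin
      v * 0 + (σ + s * 1 + i * 0) ≡⟨ rearrange v r s σ i ⟩
      (s + r) * 0 + σ + s         ≡⟨ cong (_+ s) total ⟩
      K + l + s                   ≡⟨ +-assoc K l s ⟩
      K + (l + s)                 ≡⟨ cong (K +_) l+s≡1+p ⟩
      K + suc p                   ≡⟨ +-suc K p ⟩
      suc (K + p) ∎

  weight-after : σ + s * 1 + r * 0 ≡ K + (l + s)
  weight-after = begin
    σ + s * 1 + r * 0   ≡⟨ rearrange σ s r ⟩
    (s + r) * 0 + σ + s ≡⟨ cong (_+ s) total ⟩
    K + l + s           ≡⟨ +-assoc K l s ⟩
    K + (l + s) ∎
    where
    open ≡-Reasoning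
    rearrange : ∀ σ s r → σ + s * 1 + r * 0 ≡ (s + r) * 0 + σ + s
    rearrange = solve-∀

module Trajectory (K p : ℕ) (f : ℕ → List ℕ) (f-suc : ∀ i → f (suc i) ≡ srStep K p (f i)) where

  f-+suc : ∀ P i → f (P + suc i) ≡ srStep K p (f (P + i))
  f-+suc P i = trans (cong f (+-suc P i)) (f-suc (P + i))

  drop-srStep : ∀ i w → ∃ λ tail → drop i (srStep K p w) ≡ drop (suc i) w ++ tail
  drop-srStep i []      = [] , drop-[] i
  drop-srStep i (x ∷ w) = drop-++-prefix i w _

  window-shift : ∀ P i → ∃ λ ext → f (P + i) ≡ drop i (f P) ++ ext
  window-shift P zero    = [] , trans (cong f (+-identityʳ P)) (sym (++-identityʳ (f P)))
  window-shift P (suc i) with window-shift (suc P) i | drop-srStep i (f P)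
  ... | ext , shifted | tail , dropped = tail ++ ext , (begin
    f (P + suc i)                  ≡⟨ cong f (+-suc P i) ⟩
    f (suc P + i)                  ≡⟨ shifted ⟩
    drop i (f (suc P)) ++ ext      ≡⟨ cong (λ w → drop i w ++ ext) (f-suc P) ⟩
    drop i (srStep K p (f P)) ++ ext ≡⟨ cong (_++ ext) dropped ⟩
    (drop (suc i) (f P) ++ tail) ++ ext ≡⟨ ++-assoc (drop (suc i) (f P)) tail ext ⟩
    drop (suc i) (f P) ++ tail ++ ext ∎)
    where open ≡-Reasoning

  output-during-run : ∀ {P i q b} Z → f P ≡ replicate q b ++ Z → i < q → head0 (f (P + i)) ≡ b
  output-during-run {P} {i} {q} {b} Z start i<q with window-shift P i
  ... | ext , shifted = trans (cong head0 shifted)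
                          (subst (λ w → head0 (drop i w ++ ext) ≡ b) (sym start) (head-drop-replicate b Z ext i<q))

  -- In the hypothesis, i steps are done and v more copies of b follow the bit shifted out.
  shift-out-run : ∀ {P} u b x L → f P ≡ replicate u b ++ L →
        (∀ i v → suc (i + v) ≡ u → nextBit K p b (replicate v b ++ L ++ replicate i x) ≡ x) →
        f (P + u) ≡ L ++ replicate u x
  shift-out-run {P} u b x L start next = go u 0 (+-identityʳ u)
    where
    go : ∀ i v → i + v ≡ u → f (P + i) ≡ replicate v b ++ L ++ replicate i x
    go zero    v refl = begin
      f (P + 0)          ≡⟨ cong f (+-identityʳ P) ⟩
      f P                ≡⟨ start ⟩
      replicate v b ++ L ≡⟨ cong (replicate v b ++_) (sym (++-identityʳ L)) ⟩
      replicate v b ++ L ++ [] ∎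
      where open ≡-Reasoning
    go (suc i) v i+v≡u = begin
      f (P + suc i)
        ≡⟨ f-+suc P i ⟩
      srStep K p (f (P + i))
        ≡⟨ cong (srStep K p) (go i (suc v) (trans (+-suc i v) i+v≡u)) ⟩
      w ++ [ nextBit K p b w ]
        ≡⟨ cong (λ y → w ++ [ y ]) (next i v i+v≡u) ⟩
      w ++ [ x ]
        ≡⟨ ++-assoc (replicate v b) _ [ x ] ⟩
      replicate v b ++ (L ++ replicate i x) ++ [ x ]
        ≡⟨ cong (replicate v b ++_) (++-assoc L (replicate i x) [ x ]) ⟩
      replicate v b ++ L ++ replicate i x ++ [ x ]
        ≡⟨ cong (λ t → replicate v b ++ L ++ t) (replicate-snoc i x) ⟩
      replicate v b ++ L ++ replicate (suc i) x ∎
      where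
      open ≡-Reasoning
      w : List ℕ
      w = replicate v b ++ L ++ replicate i x

  flip-then-copy : ∀ {P} s r b Y → f P ≡ replicate (s + r) b ++ Y →
    (∀ i v → suc (i + v) ≡ s → inBand K p (v * b + (r * b + sum Y + i * (1 ∸ b))) ≡ true) →
    (∀ i v → suc (i + v) ≡ r → inBand K p (v * b + (sum Y + s * (1 ∸ b) + i * b)) ≡ false) →
    f (P + (s + r)) ≡ (Y ++ replicate s (1 ∸ b)) ++ replicate r b
  flip-then-copy {P} s r b Y start flips holds = begin
    f (P + (s + r)) ≡⟨ cong f (sym (+-assoc P s r)) ⟩
    f (P + s + r)   ≡⟨ shift-out-run r b b (Y ++ replicate s (1 ∸ b)) flipped holding ⟩
    (Y ++ replicate s (1 ∸ b)) ++ replicate r b ∎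
    where
    open ≡-Reasoning
    flipping : ∀ i v → suc (i + v) ≡ s →
               nextBit K p b (replicate v b ++ (replicate r b ++ Y) ++ replicate i (1 ∸ b)) ≡ 1 ∸ b
    flipping i v eq = nextBit-by-band K p b (replicate v b ++ (replicate r b ++ Y) ++ replicate i (1 ∸ b))
      (trans (sum-run-tail v b _ i (1 ∸ b)) (cong (λ n → v * b + (n + i * (1 ∸ b))) (sum-replicate-++ r b Y)))
      (flips i v eq)
    holding : ∀ i v → suc (i + v) ≡ r →
              nextBit K p b (replicate v b ++ (Y ++ replicate s (1 ∸ b)) ++ replicate i b) ≡ b
    holding i v eq = nextBit-by-band K p b (replicate v b ++ (Y ++ replicate s (1 ∸ b)) ++ replicate i b)
      (trans (sum-run-tail v b _ i b) (cong (λ n → v * b + (n + i * b)) (sum-++-replicate Y s (1 ∸ b))))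
      (holds i v eq)
    flipped : f (P + s) ≡ replicate r b ++ Y ++ replicate s (1 ∸ b)
    flipped = trans (shift-out-run s b (1 ∸ b) (replicate r b ++ Y) split flipping) (++-assoc (replicate r b) Y _)
      where
      split : f P ≡ replicate s b ++ replicate r b ++ Y
      split = trans start (trans (cong (_++ Y) (sym (replicate-+ s r b))) (++-assoc (replicate s b) _ Y))

  even-phase : ∀ {P} q l Y → f P ≡ replicate q 1 ++ Y → sum (f P) ≡ K + l → l ≤ suc p →
    f (P + q) ≡ (Y ++ replicate (q ⊓ l) 0) ++ replicate (q ∸ q ⊓ l) 1 × sum (f (P + q)) ≡ K + (l ∸ q ⊓ l)
  even-phase {P} q l Y start weight l≤1+p =
    end , trans (cong sum end) (trans (sum-phase-end Y s 0 r 1) weight-after)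
    where
    s : ℕ
    s = q ⊓ l
    r : ℕ
    r = q ∸ s
    s≤l : s ≤ l
    s≤l = m⊓n≤n q l
    q-split : s + r ≡ q
    q-split = m+[n∸m]≡n (m⊓n≤m q l)
    start′ : f P ≡ replicate (s + r) 1 ++ Y
    start′ = subst (λ n → f P ≡ replicate n 1 ++ Y) (sym q-split) start
    total : (s + r) * 1 + sum Y ≡ K + l
    total = trans (sym (sum-replicate-++ (s + r) 1 Y)) (trans (cong sum (sym start′)) weight)
    open EvenPhaseArithmetic K p l s r (sum Y) total s≤l l≤1+p
    end : f (P + q) ≡ (Y ++ replicate s 0) ++ replicate r 1
    end = subst (λ n → f (P + n) ≡ (Y ++ replicate s 0) ++ replicate r 1) q-split
            (flip-then-copy s r 1 Y start′ flip-in-band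
              (λ i v eq → copy-below-band i v eq (m∸m⊓n≢0⇒m⊓n≡n (λ r≡0 → 1+n≢0 (trans eq r≡0)))))

  odd-phase : ∀ {P} q l Y → f P ≡ replicate q 0 ++ Y → sum (f P) ≡ K + l → l ≤ p →
    f (P + q) ≡ (Y ++ replicate (q ⊓ (suc p ∸ l)) 1) ++ replicate (q ∸ q ⊓ (suc p ∸ l)) 0 ×
    sum (f (P + q)) ≡ K + (l + q ⊓ (suc p ∸ l))
  odd-phase {P} q l Y start weight l≤p =
    end , trans (cong sum end) (trans (sum-phase-end Y s 1 r 0) weight-after)
    where
    s : ℕ
    s = q ⊓ (suc p ∸ l)
    r : ℕ
    r = q ∸ s
    q-split : s + r ≡ q
    q-split = m+[n∸m]≡n (m⊓n≤m q (suc p ∸ l))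
    start′ : f P ≡ replicate (s + r) 0 ++ Y
    start′ = subst (λ n → f P ≡ replicate n 0 ++ Y) (sym q-split) start
    total : (s + r) * 0 + sum Y ≡ K + l
    total = trans (sym (sum-replicate-++ (s + r) 0 Y)) (trans (cong sum (sym start′)) weight)
    filled : r ≢ 0 → l + s ≡ suc p
    filled r≢0 = trans (cong (l +_) (m∸m⊓n≢0⇒m⊓n≡n r≢0)) (m+[n∸m]≡n (m≤n⇒m≤1+n l≤p))
    open OddPhaseArithmetic K p l s r (sum Y) total
    end : f (P + q) ≡ (Y ++ replicate s 1) ++ replicate r 0
    end = subst (λ n → f (P + n) ≡ (Y ++ replicate s 1) ++ replicate r 0) q-split
            (flip-then-copy s r 0 Y start′
              (λ i v eq → flip-in-band i v eq (m+o⊓[n∸m]≤n q (m≤n⇒m≤1+n l≤p)))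
              (λ i v eq → copy-above-band i v (filled (λ r≡0 → 1+n≢0 (trans eq r≡0)))))

  -- These bounds make s_{j+1} ≥ 1, so the merged last block stays positive.
  LamBounds : Bool → ℕ → Set
  LamBounds true  l = 1 ≤ l × l ≤ suc p
  LamBounds false l = l ≤ p

  -- The window at the start of block j (P = q₁ + ⋯ + q_j) against st = (λ_j, e_j, (q_{j+1},…,q_{J+j})),
  -- with even = isEven j.
  record Aligned (even : Bool) (P : ℕ) (st : CState) : Set where
    constructor aligned
    field
      odd-length : Odd (length (CState.win st))
      positive   : AllPos (CState.win st)
      window     : f P ≡ blocks (bit even) (CState.win st) ++ replicate (CState.err st) (1 ∸ bit even)
      weight     : sum (f P) ≡ K + CState.lam st
      bounds     : LamBounds even (CState.lam st)

  aligned-even-step : ∀ {P l e q rest} → Aligned true P (cst l e (q ∷ rest)) →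
    Aligned false (P + q) (cst (l ∸ q ⊓ l) (q ∸ q ⊓ l) (rest ++ [ e + q ⊓ l ]))
  aligned-even-step {P} {l} {e} {q} {rest} (aligned odd (1≤q ∷ pos) window weight (1≤l , l≤1+p)) =
    aligned (odd-length-snoc rest odd) (AllPos-snoc pos (≤-trans 1≤s (m≤n+m s e)))
      (trans (proj₁ phase-end)
             (cong (_++ replicate (q ∸ s) 1) (blocks-absorb false rest e s (even-pred (length rest) odd))))
      (proj₂ phase-end)
      (≤-trans (∸-monoʳ-≤ l 1≤s) (∸-monoˡ-≤ 1 l≤1+p))
    where
    s : ℕ
    s = q ⊓ l
    1≤s : 1 ≤ s
    1≤s = ⊓-glb 1≤q 1≤l
    phase-end : f (P + q) ≡ ((blocks 0 rest ++ replicate e 0) ++ replicate s 0) ++ replicate (q ∸ s) 1 ×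
                sum (f (P + q)) ≡ K + (l ∸ s)
    phase-end = even-phase q l (blocks 0 rest ++ replicate e 0)
                  (trans window (++-assoc (replicate q 1) (blocks 0 rest) (replicate e 0))) weight l≤1+p

  aligned-odd-step : ∀ {P l e q rest} → Aligned false P (cst l e (q ∷ rest)) →
    Aligned true (P + q) (cst (l + q ⊓ (suc p ∸ l)) (q ∸ q ⊓ (suc p ∸ l)) (rest ++ [ e + q ⊓ (suc p ∸ l) ]))
  aligned-odd-step {P} {l} {e} {q} {rest} (aligned odd (1≤q ∷ pos) window weight l≤p) =
    aligned (odd-length-snoc rest odd) (AllPos-snoc pos (≤-trans 1≤s (m≤n+m s e)))
      (trans (proj₁ phase-end)
             (cong (_++ replicate (q ∸ s) 0) (blocks-absorb true rest e s (even-pred (length rest) odd))))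
      (proj₂ phase-end)
      (≤-trans 1≤s (m≤n+m s l) , m+o⊓[n∸m]≤n q (m≤n⇒m≤1+n l≤p))
    where
    s : ℕ
    s = q ⊓ (suc p ∸ l)
    1≤s : 1 ≤ s
    1≤s = ⊓-glb 1≤q (m<n⇒0<n∸m (s≤s l≤p))
    phase-end : f (P + q) ≡ ((blocks 1 rest ++ replicate e 1) ++ replicate s 1) ++ replicate (q ∸ s) 0 ×
                sum (f (P + q)) ≡ K + (l + s)
    phase-end = odd-phase q l (blocks 1 rest ++ replicate e 1)
                  (trans window (++-assoc (replicate q 0) (blocks 1 rest) (replicate e 1))) weight l≤p

  aligned-step : ∀ j {P st} → Aligned (isEven j) P st →
                 Aligned (isEven (suc j)) (P + head0 (CState.win st)) (cStep p j st)
  aligned-step j {st = cst l e []}       (aligned () _ _ _ _)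
  aligned-step j {st = cst l e (q ∷ rest)} a rewrite isEven-suc j with isEven j
  ... | true  = aligned-even-step a
  ... | false = aligned-odd-step a

  aligned-head-positive : ∀ {even P st} → Aligned even P st → 1 ≤ head0 (CState.win st)
  aligned-head-positive a = head-positive (Aligned.odd-length a) (Aligned.positive a)

  aligned-output : ∀ {even P st i} → Aligned even P st → i < head0 (CState.win st) →
                   head0 (f (P + i)) ≡ bit even
  aligned-output {st = cst l e []}       (aligned () _ _ _ _)
  aligned-output {even} {st = cst l e (q ∷ rest)} a =
    output-during-run _ (trans (Aligned.window a) (++-assoc (replicate q (bit even)) _ _))

mainTheorem5 : (p e0 : ℕ) (qs : List ℕ) → InMp p qs e0 →
    IsRunLengthVector (Cseq p qs e0) (Aseq p qs e0)
mainTheorem5 p e0 qs (odd , pos , heavy) = run-positive , run-constant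
  where
  K : ℕ
  K = sum (wordA qs e0) ∸ suc p
  open Trajectory K p (srWindow p qs e0) (λ _ → refl)
  C : ℕ → ℕ
  C = Cseq p qs e0
  P : ℕ → ℕ
  P = partialSum C

  aligned-at : ∀ j → Aligned (isEven j) (P j) (cState p qs e0 j)
  aligned-at zero    = aligned odd pos refl
    (sym (m∸n+n≡m (subst (suc p ≤_) (sym (sum-wordA qs e0)) heavy))) (s≤s z≤n , ≤-refl)
  aligned-at (suc j) = aligned-step j (aligned-at j)

  run-positive : ∀ j → 1 ≤ C j
  run-positive j = aligned-head-positive (aligned-at j)

  run-constant : ∀ j m → P j ≤ m → m < P (suc j) → Aseq p qs e0 m ≡ runBit j
  run-constant j m Pj≤m m<Pj+Cj =
    subst (λ n → Aseq p qs e0 n ≡ runBit j) (m+[n∸m]≡n Pj≤m)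
      (aligned-output (aligned-at j) (subst (m ∸ P j <_) (m+n∸m≡n (P j) (C j)) (∸-monoˡ-< m<Pj+Cj Pj≤m)))
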